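{- Let $(U,\varphi)$ be a finite standard closure space, $C$ a closed set, $x\in C$, and $Q=C\setminus\{y\in U: x\in\varphi^b(\{y\})\}$. Then $Q$ is a quasi-closed set with $\varphi(Q)=C$ if and only if $C=\varphi(A)$ for some $E$-generator $A$ of $x$.
   Context: $(U,\varphi)$: finite set with closure operator; standard: $\varphi(\{x\})\setminus\{x\}$ closed for all $x$. $\varphi^b(X)=\bigcup_{y\in X}\varphi(\{y\})$ (so $\varphi^b(\{y\})=\varphi(\{y\})$). $Q\subseteq U$ is quasi-closed if for every $X\subseteq Q$ with $\varphi(X)\subsetneq\varphi(Q)$ we have $\varphi(X)\subseteq Q$. $D$-generator of $x$: $A$ with $x\in\varphi(A)$, $x\notin\varphi^b(A)$, and $x\notin\varphi(B)$ for all $B$ with $\varphi^b(B)\subsetneq\varphi^b(A)$. $E$-generator of $x$: a $D$-generator $A$ of $x$ with $\varphi(A)$ inclusion-minimal among closures of $D$-generators of $x$. -}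

module Defs where

open import Data.Nat using (ℕ)
open import Data.Fin using (Fin)
open import Data.Fin.Subset
open import Data.Bool using (if_then_else_)
open import Data.List using (List; map; allFin)
open import Data.Vec using (tabulate; lookup)
open import Data.Product using (_×_; ∃)
open import Relation.Nullary using (¬_)
open import Relation.Binary.PropositionalEquality using (_≡_)

record ClosureSpace (n : ℕ) : Set where
  field
    φ          : Subset n → Subset n
    extensive  : ∀ X → X ⊆ φ X
    monotone   : ∀ {X Y} → X ⊆ Y → φ X ⊆ φ Y
    idempotent : ∀ X → φ (φ X) ≡ φ X

module _ {n : ℕ} (S : ClosureSpace n) where
  open ClosureSpace S

  Closed : Subset n → Set
  Closed X = φ X ≡ X

  Standard : Set
  Standard = ∀ (x : Fin n) → Closed (φ ⁅ x ⁆ - x)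

  φb : Subset n → Subset n
  φb X = ⋃ (map (λ y → if lookup X y then φ ⁅ y ⁆ else ⊥) (allFin n))

  QuasiClosed : Subset n → Set
  QuasiClosed Q = ∀ X → X ⊆ Q → φ X ⊂ φ Q → φ X ⊆ Q

  DGenerator : Fin n → Subset n → Set
  DGenerator x A =
    x ∈ φ A × x ∉ φb A × (∀ B → φb B ⊂ φb A → x ∉ φ B)

  EGenerator : Fin n → Subset n → Set
  EGenerator x A =
    DGenerator x A × (∀ A′ → DGenerator x A′ → ¬ (φ A′ ⊂ φ A))

  Qset : Subset n → Fin n → Subset n
  Qset C x = C ─ tabulate (λ y → lookup (φb ⁅ y ⁆) x)

{-# OPTIONS --safe #-}
-- An element y lies in Q exactly when y ∈ C and x ∉ φ{y}; so B ⊆ Q iff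
-- B ⊆ C and x ∉ φᵇ(B), and no set whose closure contains x lies in Q.
-- Inside a closed set, any B with x ∈ φ(B) ∖ φᵇ(B) can be shrunk to a
-- φᵇ-minimal such set, which is a D-generator of x.
-- If Q is quasi-closed with φ(Q) = C, a D-generator A ⊆ C cannot have
-- φ(A) ⊊ C, since quasi-closedness would put φ(A) ∋ x into Q; hence
-- φ(A) = C and A is an E-generator. Conversely, if C = φ(A) for an
-- E-generator A, then A ⊆ Q gives φ(Q) = C, and for X ⊆ Q with φ(X) ⊊ C we
-- get x ∉ φ(X), as otherwise a D-generator inside φ(X) would undercut A;
-- thus φ(X) ⊆ Q.
module Submission where

open import Defs
open import Data.Nat using (ℕ)
open import Data.Fin using (Fin)
open import Data.Fin.Subset using (Subset; _∈_)
open import Data.Product using (_×_; ∃; _,_; proj₁)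
open import Function.Bundles using (_⇔_; mk⇔)
open import Relation.Binary.PropositionalEquality using (_≡_)

open import Data.Bool using (Bool; true; false; if_then_else_)
open import Data.Fin.Subset
  using (_∉_; _⊆_; _⊂_; ⋃; ⁅_⁆; _─_; ⊥; inside; outside)
open import Data.Fin.Subset.Properties
  using (⊆-refl; ⊆-antisym; ⊆-⊂-trans; _∈?_; _⊆?_; _⊂?_; anySubset?; ∉⊥;
         x∈⁅x⁆; x∈⁅y⁆⇒x≡y; x∈p∪q⁻; x∈p∪q⁺; x∈p∧x∉q⇒x∈p─q; p─q⊆p)
open import Data.Fin.Subset.Induction using (⊂-wellFounded)
open import Data.List using (List; []; _∷_)
open import Data.List.Relation.Unary.Any using (Any; here; there)
open import Data.List.Relation.Unary.Any.Properties as Any using (map⁺; map⁻)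
open import Data.Vec.Properties using (lookup∘tabulate; []=⇒lookup; lookup⇒[]=)
import Data.Vec as Vec
open import Data.Sum using (inj₁; inj₂)
open import Function using (_on_)
open import Induction.WellFounded using (Acc; acc)
import Relation.Binary.Construct.On as On
open import Relation.Nullary using (¬_; yes; no; contradiction)
open import Relation.Nullary.Decidable using (_×-dec_; ¬?; decidable-stable)
open import Relation.Unary using (Pred; Decidable)
open import Relation.Binary.PropositionalEquality using (refl; sym; trans; subst)

private
  variable
    m n : ℕ
    x y : Fin n
    p q : Subset n

x∈p─q⇒x∉q : ∀ (p q : Subset n) → x ∈ p ─ q → x ∉ q
x∈p─q⇒x∉q (inside Vec.∷ p) (outside Vec.∷ q) Vec.here ()
x∈p─q⇒x∉q (_ Vec.∷ p) (_ Vec.∷ q) (Vec.there x∈p─q) (Vec.there x∈q) = x∈p─q⇒x∉q p q x∈p─q x∈q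

x∈tabulate⁺ : ∀ {f : Fin n → Bool} → f x ≡ true → x ∈ Vec.tabulate f
x∈tabulate⁺ {x = x} {f} fx = lookup⇒[]= x (Vec.tabulate f) (trans (lookup∘tabulate f x) fx)

x∈tabulate⁻ : ∀ {f : Fin n → Bool} → x ∈ Vec.tabulate f → f x ≡ true
x∈tabulate⁻ {x = x} {f} x∈ = trans (sym (lookup∘tabulate f x)) ([]=⇒lookup x∈)

x∈if⁺ : ∀ {b} → b ≡ true → x ∈ p → x ∈ (if b then p else ⊥)
x∈if⁺ refl x∈p = x∈p

x∈if⁻ : ∀ b → x ∈ (if b then p else ⊥) → b ≡ true × x ∈ p
x∈if⁻ true  x∈p = refl , x∈p
x∈if⁻ false x∈⊥ = contradiction x∈⊥ ∉⊥

x∈⋃⁺ : ∀ {ps : List (Subset n)} → Any (x ∈_) ps → x ∈ ⋃ ps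
x∈⋃⁺ (here x∈p)   = x∈p∪q⁺ (inj₁ x∈p)
x∈⋃⁺ (there x∈ps) = x∈p∪q⁺ (inj₂ (x∈⋃⁺ x∈ps))

x∈⋃⁻ : ∀ (ps : List (Subset n)) → x ∈ ⋃ ps → Any (x ∈_) ps
x∈⋃⁻ []       x∈⊥ = contradiction x∈⊥ ∉⊥
x∈⋃⁻ (p ∷ ps) x∈  with x∈p∪q⁻ p (⋃ ps) x∈
... | inj₁ x∈p   = here x∈p
... | inj₂ x∈⋃ps = there (x∈⋃⁻ ps x∈⋃ps)

⊆∧⊄⇒≡ : p ⊆ q → ¬ (p ⊂ q) → p ≡ q
⊆∧⊄⇒≡ {p = p} {q} p⊆q p⊄q = ⊆-antisym p⊆q q⊆p
  where
  q⊆p : q ⊆ p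
  q⊆p {y} y∈q = decidable-stable (y ∈? p) (λ y∉p → p⊄q (p⊆q , y , y∈q , y∉p))

∃-minimal-on : ∀ {ℓ} (f : Subset m → Subset n) {P : Pred (Subset m) ℓ} →
               Decidable P → ∀ {B} → P B →
               ∃ λ A → P A × (∀ B → f B ⊂ f A → ¬ P B)
∃-minimal-on f {P} P? {B} pB = descend (On.wellFounded f ⊂-wellFounded B) pB
  where
  descend : ∀ {B} → Acc (_⊂_ on f) B → P B → ∃ λ A → P A × (∀ B → f B ⊂ f A → ¬ P B)
  descend {B} (acc smaller) pB with anySubset? (λ B′ → (f B′ ⊂? f B) ×-dec P? B′)
  ... | yes (B′ , fB′⊂fB , pB′) = descend (smaller fB′⊂fB) pB′
  ... | no ∄smaller             = B , pB , λ B′ fB′⊂fB pB′ → ∄smaller (B′ , fB′⊂fB , pB′)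

module _ (S : ClosureSpace n) where
  open ClosureSpace S

  x∈φb⁺ : ∀ {X} → y ∈ X → x ∈ φ ⁅ y ⁆ → x ∈ φb S X
  x∈φb⁺ {y = y} y∈X x∈φy =
    x∈⋃⁺ (map⁺ (Any.tabulate⁺ y (x∈if⁺ ([]=⇒lookup y∈X) x∈φy)))

  x∈φb⁻ : ∀ X → x ∈ φb S X → ∃ λ y → y ∈ X × x ∈ φ ⁅ y ⁆
  x∈φb⁻ X x∈ with Any.tabulate⁻ (map⁻ (x∈⋃⁻ _ x∈))
  ... | y , x∈if with x∈if⁻ (Vec.lookup X y) x∈if
  ...   | X[y] , x∈φy = y , lookup⇒[]= y X X[y] , x∈φy

  ⊆φb : ∀ X → X ⊆ φb S X
  ⊆φb X {y} y∈X = x∈φb⁺ y∈X (extensive ⁅ y ⁆ (x∈⁅x⁆ y))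

  φb⊆φ : ∀ X → φb S X ⊆ φ X
  φb⊆φ X x∈ with x∈φb⁻ X x∈
  ... | y , y∈X , x∈φy = monotone ⁅y⁆⊆X x∈φy
    where
    ⁅y⁆⊆X : ⁅ y ⁆ ⊆ X
    ⁅y⁆⊆X z∈⁅y⁆ = subst (_∈ X) (sym (x∈⁅y⁆⇒x≡y y z∈⁅y⁆)) y∈X

  φ-least : ∀ {X Y} → Closed S Y → X ⊆ Y → φ X ⊆ Y
  φ-least closedY X⊆Y x∈φX = subst (_ ∈_) closedY (monotone X⊆Y x∈φX)

  minimal⇒DGenerator :
    ∀ {A Y} → Closed S Y → A ⊆ Y → x ∈ φ A → x ∉ φb S A →
    (∀ B → φb S B ⊂ φb S A → ¬ (B ⊆ Y × x ∈ φ B × x ∉ φb S B)) →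
    DGenerator S x A
  minimal⇒DGenerator {A = A} {Y} closedY A⊆Y x∈φA x∉φbA minimal =
    x∈φA , x∉φbA , λ B φbB⊂φbA x∈φB →
      minimal B φbB⊂φbA (B⊆Y B φbB⊂φbA , x∈φB , λ x∈φbB → x∉φbA (proj₁ φbB⊂φbA x∈φbB))
    where
    B⊆Y : ∀ B → φb S B ⊂ φb S A → B ⊆ Y
    B⊆Y B φbB⊂φbA b∈B = φ-least closedY A⊆Y (φb⊆φ A (proj₁ φbB⊂φbA (⊆φb B b∈B)))

  DGenerator-within :
    ∀ {B Y} → Closed S Y → B ⊆ Y → x ∈ φ B → x ∉ φb S B →
    ∃ λ A → DGenerator S x A × A ⊆ Y
  DGenerator-within {x = x} {Y = Y} closedY B⊆Y x∈φB x∉φbB =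
    let A , (A⊆Y , x∈φA , x∉φbA) , minimal = ∃-minimal-on (φb S) witness? (B⊆Y , x∈φB , x∉φbB)
    in  A , minimal⇒DGenerator closedY A⊆Y x∈φA x∉φbA minimal , A⊆Y
    where
    witness? : Decidable (λ B → B ⊆ Y × x ∈ φ B × x ∉ φb S B)
    witness? B = (B ⊆? Y) ×-dec (x ∈? φ B) ×-dec ¬? (x ∈? φb S B)

  EGenerator⇒∉φ : ∀ {A X} → EGenerator S x A → x ∉ φb S X → φ X ⊂ φ A → x ∉ φ X
  EGenerator⇒∉φ {X = X} (_ , leastClosure) x∉φbX φX⊂φA x∈φX
    with DGenerator-within (idempotent X) (extensive X) x∈φX x∉φbX
  ... | A′ , DA′ , A′⊆φX =
    leastClosure A′ DA′ (⊆-⊂-trans (φ-least (idempotent X) A′⊆φX) φX⊂φA)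

  Qset⊆ : ∀ C x → Qset S C x ⊆ C
  Qset⊆ C x = p─q⊆p C _

  ∈Qset⁺ : ∀ {C} → y ∈ C → x ∉ φ ⁅ y ⁆ → y ∈ Qset S C x
  ∈Qset⁺ {y = y} y∈C x∉φy = x∈p∧x∉q⇒x∈p─q y∈C λ y∈ →
    x∉φy (φb⊆φ ⁅ y ⁆ (lookup⇒[]= _ _ (x∈tabulate⁻ y∈)))

  ∈Qset⁻ : ∀ {C} → y ∈ Qset S C x → x ∉ φ ⁅ y ⁆
  ∈Qset⁻ {y = y} {C = C} y∈Q x∈φy =
    x∈p─q⇒x∉q C _ y∈Q (x∈tabulate⁺ ([]=⇒lookup (x∈φb⁺ (x∈⁅x⁆ y) x∈φy)))

  ⊆Qset⁺ : ∀ {B C} → B ⊆ C → x ∉ φb S B → B ⊆ Qset S C x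
  ⊆Qset⁺ B⊆C x∉φbB y∈B = ∈Qset⁺ (B⊆C y∈B) (λ x∈φy → x∉φbB (x∈φb⁺ y∈B x∈φy))

  ⊆Qset⁻ : ∀ {B C} → B ⊆ Qset S C x → x ∉ φb S B
  ⊆Qset⁻ {B = B} B⊆Q x∈φbB with x∈φb⁻ B x∈φbB
  ... | y , y∈B , x∈φy = ∈Qset⁻ (B⊆Q y∈B) x∈φy

  module _ {C : Subset n} {x : Fin n} (closedC : Closed S C)
           (quasiClosed : QuasiClosed S (Qset S C x)) (φQ≡C : φ (Qset S C x) ≡ C) where

    quasiClosed⇒φ⊄ : ∀ {B} → B ⊆ C → x ∈ φ B → x ∉ φb S B → ¬ (φ B ⊂ C)
    quasiClosed⇒φ⊄ {B} B⊆C x∈φB x∉φbB φB⊂C = ⊆Qset⁻ φB⊆Q (⊆φb (φ B) x∈φB)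
      where
      φB⊆Q : φ B ⊆ Qset S C x
      φB⊆Q = quasiClosed B (⊆Qset⁺ B⊆C x∉φbB) (subst (φ B ⊂_) (sym φQ≡C) φB⊂C)

    DGenerator⇒EGenerator : ∀ {A} → DGenerator S x A → A ⊆ C → EGenerator S x A × C ≡ φ A
    DGenerator⇒EGenerator {A} DA@(x∈φA , x∉φbA , _) A⊆C = (DA , leastClosure) , sym φA≡C
      where
      φA≡C : φ A ≡ C
      φA≡C = ⊆∧⊄⇒≡ (φ-least closedC A⊆C) (quasiClosed⇒φ⊄ A⊆C x∈φA x∉φbA)

      leastClosure : ∀ A′ → DGenerator S x A′ → ¬ (φ A′ ⊂ φ A)
      leastClosure A′ (x∈φA′ , x∉φbA′ , _) φA′⊂φA = quasiClosed⇒φ⊄ A′⊆C x∈φA′ x∉φbA′ φA′⊂C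
        where
        φA′⊂C : φ A′ ⊂ C
        φA′⊂C = subst (φ A′ ⊂_) φA≡C φA′⊂φA
        A′⊆C : A′ ⊆ C
        A′⊆C a∈A′ = proj₁ φA′⊂C (extensive A′ a∈A′)

    quasiClosed⇒EGenerator : x ∈ C → ∃ λ A → EGenerator S x A × C ≡ φ A
    quasiClosed⇒EGenerator x∈C
      with DGenerator-within closedC (Qset⊆ C x) (subst (x ∈_) (sym φQ≡C) x∈C) (⊆Qset⁻ {C = C} ⊆-refl)
    ... | A , DA , A⊆C = A , DGenerator⇒EGenerator DA A⊆C

  EGenerator⇒quasiClosed : ∀ {A C} → Closed S C → EGenerator S x A → C ≡ φ A →
                           QuasiClosed S (Qset S C x) × φ (Qset S C x) ≡ C
  EGenerator⇒quasiClosed {x = x} {A} {C} closedC EA@((_ , x∉φbA , _) , _) C≡φA =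
    quasiClosed , φQ≡C
    where
    A⊆Q : A ⊆ Qset S C x
    A⊆Q = ⊆Qset⁺ (λ a∈A → subst (_ ∈_) (sym C≡φA) (extensive A a∈A)) x∉φbA

    φQ≡C : φ (Qset S C x) ≡ C
    φQ≡C = ⊆-antisym (φ-least closedC (Qset⊆ C x))
                     (λ c∈C → monotone A⊆Q (subst (_ ∈_) C≡φA c∈C))

    quasiClosed : QuasiClosed S (Qset S C x)
    quasiClosed X X⊆Q φX⊂φQ = ⊆Qset⁺ φX⊆C x∉φbφX
      where
      φX⊆C : φ X ⊆ C
      φX⊆C z∈φX = subst (_ ∈_) φQ≡C (proj₁ φX⊂φQ z∈φX)
      x∉φX : x ∉ φ X
      x∉φX = EGenerator⇒∉φ EA (⊆Qset⁻ X⊆Q) (subst (φ X ⊂_) (trans φQ≡C C≡φA) φX⊂φQ)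
      x∉φbφX : x ∉ φb S (φ X)
      x∉φbφX x∈ = x∉φX (φ-least (idempotent X) ⊆-refl (φb⊆φ (φ X) x∈))

lemma2 : ∀ {n : ℕ} (S : ClosureSpace n) → Standard S →
         ∀ (C : Subset n) (x : Fin n) → Closed S C → x ∈ C →
         (QuasiClosed S (Qset S C x) × ClosureSpace.φ S (Qset S C x) ≡ C)
           ⇔ ∃ (λ A → EGenerator S x A × C ≡ ClosureSpace.φ S A)
lemma2 S _ C x closedC x∈C = mk⇔
  (λ (quasiClosed , φQ≡C) → quasiClosed⇒EGenerator S closedC quasiClosed φQ≡C x∈C)
  (λ (A , EA , C≡φA) → EGenerator⇒quasiClosed S closedC EA C≡φA)
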